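{- Let $N\ge 3$ be a prime and let $g,\gamma$ be integers with $\gamma>0$, $g\ge\gamma$, $\frac{N-1}{2}$ dividing $g-\gamma$, and $\big(\frac{2(g-\gamma)}{N-1}\big)_N\neq N-1$. Let \[ {\rm S}_N:=N \langle 2,2\gamma+1 \rangle+ \Big\langle \tfrac{2(g-\gamma)}{N-1}+1,\ \tfrac{2(g-\gamma)}{N-1}+N+1 \Big\rangle\subseteq\mathbb{N} \] and ${\rm G}=\mathbb{N}\setminus{\rm S}_N$. Then for every integer $n\ge 2$, \[ \# n({\rm G}) \leq (2n-1)(g-1), \] where $n({\rm G})$ denotes the set of all sums of $n$ (not necessarily distinct) elements of ${\rm G}$.
   Context: $\mathbb{N}=\{0,1,2,\dots\}$. For positive integers $a_1,\dots,a_k$, $\langle a_1,\dots,a_k\rangle$ denotes the submonoid of $\mathbb{N}$ generated by them, $N\langle\cdot\rangle$ its image under multiplication by $N$, and $A+B=\{a+b: a\in A,\ b\in B\}$. $(x)_M$ denotes the residue of $x$ modulo $M$ in $\{0,\dots,M-1\}$. -}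

module Defs where

open import Data.Nat using (ℕ; zero; suc; _+_; _*_; _∸_)
open import Data.Nat.DivMod using (_/_; _%_)
open import Data.Product using (∃₂; _×_; ∃)
open import Data.Vec using (Vec)
open import Data.Vec.Relation.Unary.All using (All)
open import Relation.Binary.PropositionalEquality using (_≡_)
open import Relation.Nullary using (¬_)
import Data.Vec as V

-- (x)_M : residue of x modulo M (only used with M > 0; M = 0 case is a dummy)
res : ℕ → ℕ → ℕ
res x zero    = x
res x (suc k) = x % suc k

-- integer quotient x / M (only used with M > 0; M = 0 case is a dummy)
quot : ℕ → ℕ → ℕ
quot x zero    = 0
quot x (suc k) = x / suc k

In⟨_,_⟩ : ℕ → ℕ → ℕ → Set
In⟨ a , b ⟩ x = ∃₂ λ i j → x ≡ i * a + j * b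

qq : ℕ → ℕ → ℕ → ℕ
qq N g γ = quot (2 * (g ∸ γ)) (N ∸ 1)

InS : ℕ → ℕ → ℕ → ℕ → Set
InS N g γ x = ∃₂ λ s t → In⟨ 2 , 2 * γ + 1 ⟩ s × In⟨ qq N g γ + 1 , qq N g γ + N + 1 ⟩ t
                        × x ≡ N * s + t

InG : ℕ → ℕ → ℕ → ℕ → Set
InG N g γ x = ¬ InS N g γ x

InSumset : ℕ → (ℕ → Set) → ℕ → Set
InSumset n P x = ∃ λ (v : Vec ℕ n) → All P v × x ≡ V.sum v

module Submission where

open import Defs
open import Data.Nat using (ℕ; _+_; _*_; _∸_; _≤_; _>_; _≥_)
open import Data.Nat.Divisibility using (_∣_)
open import Data.Nat.Primality using (Prime)
open import Data.List using (List; length)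
open import Data.List.Relation.Unary.All using (All)
open import Data.List.Relation.Unary.Unique.Propositional using (Unique)
open import Relation.Binary.PropositionalEquality using (_≢_)

open import Data.Nat using (zero; suc; _<_; _≤?_; _<?_; z≤n; s≤s; NonZero)
open import Data.Nat.Properties
open import Data.Nat.DivMod using (_/_; _%_; m*n/n≡m; %-pred-≡0; m≡m%n+[m/n]*n; m%n<n; [m+kn]%n≡m%n; m<n⇒m%n≡m)
open import Data.Nat.Coprimality using (Coprime; coprime-Bézout)
open import Data.Nat.Divisibility using (divides; n∣m⇒m%n≡0)
open import Data.Nat.Primality using (prime⇒irreducible)
open import Data.Nat.GCD using (module Bézout)
open import Data.Nat.Tactic.RingSolver using (solve-∀)
open import Data.Fin using (Fin; toℕ; fromℕ<)
open import Data.Fin.Properties using (injective⇒≤; toℕ-fromℕ<)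
open import Data.List using ([]; _∷_; lookup)
open import Data.List.Relation.Unary.All using ([]; _∷_)
import Data.List.Relation.Unary.All as All
open import Data.List.Relation.Unary.AllPairs using (_∷_)
open import Data.Vec using (Vec; []; _∷_)
import Data.Vec as Vec
open import Data.Vec.Relation.Unary.All using () renaming (All to AllV; [] to []ᵛ; _∷_ to _∷ᵛ_)
import Data.Vec.Relation.Unary.All as AllV
open import Data.Product using (∃; ∃₂; _×_; _,_; proj₁; proj₂)
open import Data.Sum using (_⊎_; inj₁; inj₂; [_,_]′)
open import Data.Empty using (⊥-elim)
open import Function using (_∘_)
open import Relation.Nullary using (¬_; Dec; yes; no)
open import Relation.Binary.PropositionalEquality using (_≡_; refl; sym; trans; cong; cong₂; subst; subst₂; module ≡-Reasoning)

-- Proposition 3.5.  Write N = 2h + 1 and a = q + 1, q = 2(g-γ)/(N-1), so that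
-- g - γ = qh.  If q = 0 then S_N = ℕ and there is nothing to count.  Otherwise
-- N ∤ a, and ⟨a, N⟩ has Frobenius number F = Na - a - N = 2hq - 1 and genus
-- g₀ = hq = g - γ; the gaps of S_N ⊆ ⟨a, N⟩ are those of ⟨a, N⟩ and the odd
-- multiples eN with e < 2γ, e < a.
--   * Gap classification (`gap-kind`): a gap x satisfies x + sa + tN = F, or
--     x + bN = F + a with b ≥ a - 2γ and b + a even.
--   * Adding n gaps gives a linear relation for their sum Y (`sum-shape`).
--   * From that relation Y receives a code κ < (2n-1)(g-1) with Y = decode κ
--     (`Encoding`): (2n-1)(g₀-1) codes for the Y with nF - Y ∈ ⟨a, N⟩, using
--     the symmetry of ⟨a, N⟩ on [0, F], and (2n-1)γ codes for the others.
--   * A duplicate-free list of coded numbers is at most as long as the number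
--     of codes (`length≤codes`).
-- The coding needs g₀ ≥ 2; when g₀ = 1 (N = 3, q = 1) the gaps are 1 and 3 and
-- the n-fold sums are counted directly (`SmallestCase`).

parity : ℕ → ℕ
parity zero          = 0
parity (suc zero)    = 1
parity (suc (suc k)) = parity k

half : ℕ → ℕ
half zero          = 0
half (suc zero)    = 0
half (suc (suc k)) = suc (half k)

Even : ℕ → Set
Even b = ∃ λ e → b ≡ 2 * e

parity+2half : ∀ k → parity k + 2 * half k ≡ k
parity+2half zero          = refl
parity+2half (suc zero)    = refl
parity+2half (suc (suc k)) = begin
  parity k + 2 * suc (half k)        ≡⟨ cong (parity k +_) (*-suc 2 (half k)) ⟩
  parity k + suc (suc (2 * half k))  ≡⟨ +-suc (parity k) (suc (2 * half k)) ⟩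
  suc (parity k + suc (2 * half k))  ≡⟨ cong suc (+-suc (parity k) (2 * half k)) ⟩
  suc (suc (parity k + 2 * half k))  ≡⟨ cong (suc ∘ suc) (parity+2half k) ⟩
  suc (suc k)                        ∎
  where open ≡-Reasoning

parity≤1 : ∀ k → parity k ≤ 1
parity≤1 zero          = z≤n
parity≤1 (suc zero)    = s≤s z≤n
parity≤1 (suc (suc k)) = parity≤1 k

parity-2t : ∀ t → parity (2 * t) ≡ 0
parity-2t zero    = refl
parity-2t (suc t) = trans (cong parity (*-suc 2 t)) (parity-2t t)

parity-2t+1 : ∀ t → parity (suc (2 * t)) ≡ 1
parity-2t+1 zero    = refl
parity-2t+1 (suc t) = trans (cong (parity ∘ suc) (*-suc 2 t)) (parity-2t+1 t)

parity-of-even-sum : ∀ K X → Even (K + X) → parity K ≡ parity X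
parity-of-even-sum zero          X (t , eq)           = sym (trans (cong parity eq) (parity-2t t))
parity-of-even-sum (suc zero)    X (suc t , eq)       =
  sym (trans (cong parity (suc-injective (trans eq (*-suc 2 t)))) (parity-2t+1 t))
parity-of-even-sum (suc (suc K)) X (suc t , eq)       =
  parity-of-even-sum K X (t , suc-injective (suc-injective (trans eq (*-suc 2 t))))
parity-of-even-sum (suc zero)    X (zero , ())
parity-of-even-sum (suc (suc K)) X (zero , ())

Coded : (ℕ → ℕ) → ℕ → ℕ → Set
Coded dec B y = ∃ λ κ → κ < B × dec κ ≡ y

length≤codes : (dec : ℕ → ℕ) (B : ℕ) (xs : List ℕ) → Unique xs → All (Coded dec B) xs → length xs ≤ B
length≤codes dec B xs unique coded = injective⇒≤ {f = code} code-injective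
  where
  lookupAll : ∀ {P : ℕ → Set} {ys : List ℕ} → All P ys → (i : Fin (length ys)) → P (lookup ys i)
  lookupAll (py ∷ _)   Fin.zero    = py
  lookupAll (_  ∷ pys) (Fin.suc i) = lookupAll pys i

  lookup-injective : ∀ {ys : List ℕ} → Unique ys → (i j : Fin (length ys)) → lookup ys i ≡ lookup ys j → i ≡ j
  lookup-injective (_  ∷ _) Fin.zero    Fin.zero    _  = refl
  lookup-injective (y≢ ∷ _) Fin.zero    (Fin.suc j) eq = ⊥-elim (lookupAll y≢ j eq)
  lookup-injective (y≢ ∷ _) (Fin.suc i) Fin.zero    eq = ⊥-elim (lookupAll y≢ i (sym eq))
  lookup-injective (_  ∷ u) (Fin.suc i) (Fin.suc j) eq = cong Fin.suc (lookup-injective u i j eq)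

  codeOf : (i : Fin (length xs)) → ℕ
  codeOf i = proj₁ (lookupAll coded i)

  code : Fin (length xs) → Fin B
  code i = fromℕ< (proj₁ (proj₂ (lookupAll coded i)))

  code-injective : ∀ {i j} → code i ≡ code j → i ≡ j
  code-injective {i} {j} eq = lookup-injective unique i j (begin
    lookup xs i        ≡⟨ sym (proj₂ (proj₂ (lookupAll coded i))) ⟩
    dec (codeOf i)     ≡⟨ cong dec same-code ⟩
    dec (codeOf j)     ≡⟨ proj₂ (proj₂ (lookupAll coded j)) ⟩
    lookup xs j        ∎)
    where
    open ≡-Reasoning
    same-code : codeOf i ≡ codeOf j
    same-code = trans (sym (toℕ-fromℕ< _)) (trans (cong toℕ eq) (toℕ-fromℕ< _))

divmod-linear : ∀ m k K .{{_ : NonZero K}} → k < K → (m * K + k) / K ≡ m × (m * K + k) % K ≡ k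
divmod-linear m k K k<K = quotient , remainder
  where
  remainder : (m * K + k) % K ≡ k
  remainder = trans (cong (_% K) (+-comm (m * K) k)) (trans ([m+kn]%n≡m%n k m K) (m<n⇒m%n≡m k<K))
  quotient : (m * K + k) / K ≡ m
  quotient = *-cancelʳ-≡ _ _ K (+-cancelˡ-≡ k _ _ (begin
    k + (m * K + k) / K * K             ≡⟨ cong (_+ (m * K + k) / K * K) (sym remainder) ⟩
    (m * K + k) % K + (m * K + k) / K * K ≡⟨ sym (m≡m%n+[m/n]*n (m * K + k) K) ⟩
    m * K + k                           ≡⟨ +-comm (m * K) k ⟩
    k + m * K                           ∎))
    where open ≡-Reasoning

equal-halves : ∀ x y F → x + y ≡ F + F → x ≤ F → y ≤ F → x ≡ y
equal-halves x y F eq x≤F y≤F = trans x≡F (sym y≡F)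
  where
  x≡F : x ≡ F
  x≡F = ≤-antisym x≤F (≮⇒≥ (λ x<F → <⇒≢ (+-mono-<-≤ x<F y≤F) eq))
  y≡F : y ≡ F
  y≡F = +-cancelˡ-≡ F _ _ (trans (cong (_+ y) (sym x≡F)) eq)

-- If N = m + 1 is coprime to a, every x is congruent modulo N to w * a with
-- w < N; in ℕ this reads x + u * N ≡ w * a + v * N.  By Bézout, x ≡ x Y a or
-- x ≡ -x Y a ≡ m x Y a (mod N), and w is the residue of the multiplier.
residue-as-multiple : ∀ m a → Coprime (suc m) a →
  ∀ x → ∃ λ w → w < suc m × ∃₂ λ u v → x + u * suc m ≡ w * a + v * suc m
residue-as-multiple m a coprime x with coprime-Bézout coprime
... | Bézout.+- X Y bez = W % N , m%n<n W N , x * Y * a , x * X + W / N * a , (begin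
    x + x * Y * a * N                        ≡⟨ expand x Y a m ⟩
    x * (1 + Y * a) + W * a                  ≡⟨ cong₂ (λ p r → p + r * a) (cong (x *_) bez) (m≡m%n+[m/n]*n W N) ⟩
    x * (X * N) + (W % N + W / N * N) * a    ≡⟨ regroup x X N (W % N) (W / N) a ⟩
    W % N * a + (x * X + W / N * a) * N      ∎)
  where
  open ≡-Reasoning
  N W : ℕ
  N = suc m
  W = m * (x * Y)
  expand : ∀ x Y a m → x + x * Y * a * suc m ≡ x * (1 + Y * a) + m * (x * Y) * a
  expand = solve-∀
  regroup : ∀ x X N r t a → x * (X * N) + (r + t * N) * a ≡ r * a + (x * X + t * a) * N
  regroup = solve-∀
... | Bézout.-+ X Y bez = W % N , m%n<n W N , x * X , W / N * a , (begin
    x + x * X * N                  ≡⟨ factor x X N ⟩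
    x * (1 + X * N)                ≡⟨ cong (x *_) bez ⟩
    x * (Y * a)                    ≡⟨ sym (*-assoc x Y a) ⟩
    W * a                          ≡⟨ cong (_* a) (m≡m%n+[m/n]*n W N) ⟩
    (W % N + W / N * N) * a        ≡⟨ regroup (W % N) (W / N) N a ⟩
    W % N * a + W / N * a * N      ∎)
  where
  open ≡-Reasoning
  N W : ℕ
  N = suc m
  W = x * Y
  factor : ∀ x X N → x + x * X * N ≡ x * (1 + X * N)
  factor = solve-∀
  regroup : ∀ r t N a → (r + t * N) * a ≡ r * a + t * a * N
  regroup = solve-∀

offset-below : ∀ x w M → x ≤ M → M < w + x → M ∸ x < w
offset-below x w M x≤M M< = +-cancelʳ-< x (M ∸ x) w (subst (_< w + x) (sym (m∸n+n≡m x≤M)) M<)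

difference : ∀ Y d X → Y + d ≡ X → X ∸ d ≡ Y
difference Y d X eq = trans (cong (_∸ d) (sym eq)) (m+n∸n≡m Y d)

2[2+n]∸1 : ∀ n' → 2 * suc (suc n') ∸ 1 ≡ 3 + 2 * n'
2[2+n]∸1 n' = cong (_∸ 1) (identity n')
  where
  identity : ∀ n' → 2 * (2 + n') ≡ 4 + 2 * n'
  identity = solve-∀

ifDec : ∀ {p} {P : Set p} → Dec P → ℕ → ℕ → ℕ
ifDec (yes _) x y = x
ifDec (no _)  x y = y

ifDec-yes : ∀ {p} {P : Set p} (d : Dec P) {x y : ℕ} → P → ifDec d x y ≡ x
ifDec-yes (yes _)  _ = refl
ifDec-yes (no ¬p)  p = ⊥-elim (¬p p)

ifDec-no : ∀ {p} {P : Set p} (d : Dec P) {x y : ℕ} → ¬ P → ifDec d x y ≡ y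
ifDec-no (yes p) ¬p = ⊥-elim (¬p p)
ifDec-no (no _)  _  = refl

cancel-multiple : ∀ N x y u v → u ≤ v → x + u * N ≡ y + v * N → x ≡ y + (v ∸ u) * N
cancel-multiple N x y u v u≤v eq = +-cancelʳ-≡ (u * N) _ _ (begin
  x + u * N                  ≡⟨ eq ⟩
  y + v * N                  ≡⟨ cong (λ z → y + z * N) (sym (m∸n+n≡m u≤v)) ⟩
  y + (v ∸ u + u) * N        ≡⟨ cong (y +_) (*-distribʳ-+ N (v ∸ u) u) ⟩
  y + ((v ∸ u) * N + u * N)  ≡⟨ sym (+-assoc y _ _) ⟩
  y + (v ∸ u) * N + u * N    ∎)
  where open ≡-Reasoning

-- The semigroup S = N⟨2, 2γ+1⟩ + ⟨a, a+N⟩ with N = 2h+1, a = q+1, in which all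
-- side conditions h, q, γ ≥ 1 hold by construction.  ⟨a, N⟩ has genus
-- g₀ = hq and Frobenius number F = 2g₀ - 1 = Na - a - N.
module Setting (h' q' γ' : ℕ) where

  h q a N γ G g₀ F δ : ℕ
  h  = suc h'
  q  = suc q'
  a  = suc q
  N  = suc (2 * h)
  γ  = suc γ'
  G  = q' + h' * q
  g₀ = suc G
  F  = suc (2 * G)
  δ  = a ∸ 2 * γ

  frobenius : F + a + N ≡ N * a
  frobenius = identity q' h'
    where
    identity : ∀ q' h' → suc (2 * (q' + h' * suc q')) + suc (suc q') + suc (2 * suc h')
                         ≡ suc (2 * suc h') * suc (suc q')
    identity = solve-∀

  F+a≡qN : F + a ≡ q * N
  F+a≡qN = identity q' h'
    where
    identity : ∀ q' h' → suc (2 * (q' + h' * suc q')) + suc (suc q') ≡ suc q' * suc (2 * suc h')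
    identity = solve-∀

  InSemigroup : ℕ → Set
  InSemigroup x = ∃₂ λ s t → In⟨ 2 , 2 * γ + 1 ⟩ s × In⟨ a , a + N ⟩ t × x ≡ N * s + t

  mem-multiple : ∀ e → In⟨ 2 , 2 * γ + 1 ⟩ e → InSemigroup (e * N)
  mem-multiple e e∈ = e , 0 , e∈ , (0 , 0 , refl) , trans (*-comm e N) (sym (+-identityʳ (N * e)))

  -- w a + e N ∈ S for w ≥ 1: write e = p + 2H with p ≤ 1 and use p copies of a + N.
  mem-wa+eN : ∀ w e → 1 ≤ w → InSemigroup (w * a + e * N)
  mem-wa+eN w e 1≤w =
    half e * 2 , (w ∸ p) * a + p * (a + N) , (half e , 0 , sym (+-identityʳ _)) , (w ∸ p , p , refl) , (begin
      w * a + e * N                                   ≡⟨ cong₂ (λ A B → A * a + B * N) (sym (m∸n+n≡m (≤-trans (parity≤1 e) 1≤w))) (sym (parity+2half e)) ⟩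
      ((w ∸ p) + p) * a + (p + 2 * half e) * N        ≡⟨ regroup (w ∸ p) p a (half e) N ⟩
      N * (half e * 2) + ((w ∸ p) * a + p * (a + N))  ∎)
    where
    open ≡-Reasoning
    p : ℕ
    p = parity e
    regroup : ∀ W p a H N → (W + p) * a + (p + 2 * H) * N ≡ N * (H * 2) + (W * a + p * (a + N))
    regroup = solve-∀

  -- e N ∈ S for e ≥ a, as e N = N a + (e ∸ a) N.
  mem-eN : ∀ e → a ≤ e → InSemigroup (e * N)
  mem-eN e a≤e = subst InSemigroup eq (mem-wa+eN N (e ∸ a) (s≤s z≤n))
    where
    eq : N * a + (e ∸ a) * N ≡ e * N
    eq = trans (cong (_+ (e ∸ a) * N) (*-comm N a))
               (trans (sym (*-distribʳ-+ N a (e ∸ a))) (cong (_* N) (m+[n∸m]≡n a≤e)))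

  -- Gaps of the first kind are the gaps of ⟨a, N⟩: x ∉ ⟨a, N⟩ iff F - x ∈ ⟨a, N⟩.
  FirstKind : ℕ → Set
  FirstKind x = ∃₂ λ s t → x + s * a + t * N ≡ F

  -- Gaps of the second kind are the x = eN with e odd, e < 2γ, e < a; they are
  -- recorded through b = q - e, which satisfies x + bN = F + a.
  SecondKind : ℕ → Set
  SecondKind x = ∃ λ b → x + b * N ≡ F + a × δ ≤ b × Even (b + a)

  Gap : ℕ → Set
  Gap x = 1 ≤ x × (FirstKind x ⊎ SecondKind x)

  -- If x + (e+1)N = w a with w < N then F - x = (N-1-w) a + e N.
  first-kind : ∀ x w e → w < N → x + suc e * N ≡ w * a → FirstKind x
  first-kind x w e w<N eq = s , e , +-cancelʳ-≡ a _ _ (+-cancelʳ-≡ N _ _ (begin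
      x + s * a + e * N + a + N    ≡⟨ regroup x s e a N ⟩
      (x + suc e * N) + suc s * a  ≡⟨ cong (_+ suc s * a) eq ⟩
      w * a + suc s * a            ≡⟨ sym (*-distribʳ-+ a w (suc s)) ⟩
      (w + suc s) * a              ≡⟨ cong (_* a) (trans (+-suc w s) (m+[n∸m]≡n w<N)) ⟩
      N * a                        ≡⟨ sym frobenius ⟩
      F + a + N                    ∎))
    where
    open ≡-Reasoning
    s : ℕ
    s = N ∸ suc w
    regroup : ∀ x s e a N → x + s * a + e * N + a + N ≡ (x + suc e * N) + suc s * a
    regroup = solve-∀

  -- e N ∈ S for odd e ≥ 2γ + 1, as e = 2(H - γ) + (2γ + 1).
  mem-odd-multiple : ∀ e H → 1 + 2 * H ≡ e → 2 * γ + 1 ≤ e → InSemigroup (e * N)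
  mem-odd-multiple e H odd large = mem-multiple e (H ∸ γ , 1 , (begin
      e                              ≡⟨ sym odd ⟩
      1 + 2 * H                      ≡⟨ cong (λ z → 1 + 2 * z) (sym (m∸n+n≡m γ≤H)) ⟩
      1 + 2 * (H ∸ γ + γ)            ≡⟨ identity (H ∸ γ) γ ⟩
      (H ∸ γ) * 2 + 1 * (2 * γ + 1)  ∎))
    where
    open ≡-Reasoning
    γ≤H : γ ≤ H
    γ≤H = *-cancelˡ-≤ 2 (≤-pred (subst (_≤ 1 + 2 * H) (+-comm (2 * γ) 1) (subst (2 * γ + 1 ≤_) (sym odd) large)))
    identity : ∀ D γ → 1 + 2 * (D + γ) ≡ D * 2 + 1 * (2 * γ + 1)
    identity = solve-∀

  -- e N with e = 1 + 2H < a and e < 2γ is of the second kind, with b = a - (e + 1).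
  second-kind : ∀ e H → 1 + 2 * H ≡ e → e < a → e < 2 * γ → SecondKind (e * N)
  second-kind e H odd e<a e<2γ = b , multiple , ∸-monoʳ-≤ a e<2γ , (b + 1 + H , b+a-even)
    where
    open ≡-Reasoning
    b : ℕ
    b = a ∸ suc e
    b+e+1≡a : b + suc e ≡ a
    b+e+1≡a = m∸n+n≡m e<a
    multiple : e * N + b * N ≡ F + a
    multiple = begin
      e * N + b * N  ≡⟨ sym (*-distribʳ-+ N e b) ⟩
      (e + b) * N    ≡⟨ cong (_* N) (suc-injective (trans (+-comm (suc e) b) b+e+1≡a)) ⟩
      q * N          ≡⟨ sym F+a≡qN ⟩
      F + a          ∎
    b+a-even : b + a ≡ 2 * (b + 1 + H)
    b+a-even = begin
      b + a                      ≡⟨ cong (b +_) (sym b+e+1≡a) ⟩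
      b + (b + suc e)            ≡⟨ cong (λ z → b + (b + suc z)) (sym odd) ⟩
      b + (b + suc (1 + 2 * H))  ≡⟨ identity b H ⟩
      2 * (b + 1 + H)            ∎
      where
      identity : ∀ b H → b + (b + suc (1 + 2 * H)) ≡ 2 * (b + 1 + H)
      identity = solve-∀

  -- A gap e N has e odd (else e N ∈ N⟨2⟩), e < 2γ (else e N ∈ N⟨2, 2γ+1⟩) and
  -- e < a (else e N ∈ ⟨a, a+N⟩), so it is of the second kind.
  multiple-gap : ∀ e → ¬ InSemigroup (e * N) → SecondKind (e * N)
  multiple-gap e gap with a ≤? e
  ... | yes a≤e = ⊥-elim (gap (mem-eN e a≤e))
  ... | no a≰e with parity e | parity+2half e | parity≤1 e
  ...   | suc (suc _) | _    | s≤s ()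
  ...   | zero        | even | _ =
          ⊥-elim (gap (mem-multiple e (half e , 0 , trans (sym even) (trans (*-comm 2 (half e)) (sym (+-identityʳ _))))))
  ...   | suc zero    | odd  | _ with 2 * γ + 1 ≤? e
  ...     | yes large = ⊥-elim (gap (mem-odd-multiple e (half e) odd large))
  ...     | no small  = second-kind e (half e) odd (≰⇒> a≰e) e<2γ
    where
    -- e = 1 + 2H < 2γ + 1 forces H < γ, so e + 1 = 2(H + 1) ≤ 2γ.
    e<2γ : e < 2 * γ
    e<2γ = subst (_≤ 2 * γ) (trans (*-suc 2 (half e)) (cong suc odd)) (*-monoʳ-≤ 2 H<γ)
      where
      H<γ : half e < γ
      H<γ = *-cancelˡ-< 2 (half e) γ (subst (_≤ 2 * γ) (sym odd)
              (≤-pred (subst (e <_) (+-comm (2 * γ) 1) (≰⇒> small))))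

  gap-kind : Coprime N a → ∀ x → ¬ InSemigroup x → Gap x
  gap-kind coprime zero     gap = ⊥-elim (gap (mem-multiple 0 (0 , 0 , refl)))
  gap-kind coprime (suc x') gap = s≤s z≤n , kind
    where
    x : ℕ
    x = suc x'
    kind : FirstKind x ⊎ SecondKind x
    kind with residue-as-multiple (2 * h) a coprime x
    ... | w , w<N , u , v , eq with u ≤? v
    ...   | no u≰v with u ∸ v | m<n⇒0<n∸m (≰⇒> u≰v) | sym (cancel-multiple N (w * a) x v u (<⇒≤ (≰⇒> u≰v)) (sym eq))
    ...     | suc e | _ | x+eN≡wa = inj₁ (first-kind x w e w<N x+eN≡wa)
    kind | w , w<N , u , v , eq | yes u≤v with w | cancel-multiple N x (w * a) u v u≤v eq
    ...     | zero   | x≡eN = inj₂ (subst SecondKind (sym x≡eN) (multiple-gap (v ∸ u) (gap ∘ subst InSemigroup (sym x≡eN))))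
    ...     | suc w' | x≡   = ⊥-elim (gap (subst InSemigroup (sym x≡) (mem-wa+eN (suc w') (v ∸ u) (s≤s z≤n))))

  -- Shape of a sum Y of k gaps of which j are of the second kind: adding up
  -- the defining equations gives Y + σa + BN = kF + ja with B ≥ jδ; if all k
  -- gaps are of the second kind, moreover σ = 0 and B + ka is even.
  record SumShape (k Y : ℕ) : Set where
    constructor shape
    field
      j σ B      : ℕ
      j≤k        : j ≤ k
      jδ≤B       : j * δ ≤ B
      balance    : Y + σ * a + B * N ≡ k * F + j * a
      all-second : j < k ⊎ (σ ≡ 0 × Even (B + k * a))

  add-first : ∀ {k x Y} → FirstKind x → SumShape k Y → SumShape (suc k) (x + Y)
  add-first {k} {x} {Y} (s , t , eq) (shape j σ B j≤k jδ≤B balance _) =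
    shape j (s + σ) (t + B) (m≤n⇒m≤1+n j≤k) (≤-trans jδ≤B (m≤n+m B t)) (begin
      x + Y + (s + σ) * a + (t + B) * N          ≡⟨ regroup x Y s σ t B a N ⟩
      (x + s * a + t * N) + (Y + σ * a + B * N)  ≡⟨ cong₂ _+_ eq balance ⟩
      F + (k * F + j * a)                        ≡⟨ sym (+-assoc F _ _) ⟩
      suc k * F + j * a                          ∎) (inj₁ (s≤s j≤k))
    where
    open ≡-Reasoning
    regroup : ∀ x Y s σ t B a N → x + Y + (s + σ) * a + (t + B) * N ≡ (x + s * a + t * N) + (Y + σ * a + B * N)
    regroup = solve-∀

  add-second : ∀ {k x Y} → SecondKind x → SumShape k Y → SumShape (suc k) (x + Y)
  add-second {k} {x} {Y} (b , eq , δ≤b , e , b+a≡2e) (shape j σ B j≤k jδ≤B balance flag) =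
    shape (suc j) σ (b + B) (s≤s j≤k) (+-mono-≤ δ≤b jδ≤B) (begin
      x + Y + σ * a + (b + B) * N          ≡⟨ regroup x Y σ b B a N ⟩
      (x + b * N) + (Y + σ * a + B * N)    ≡⟨ cong₂ _+_ eq balance ⟩
      (F + a) + (k * F + j * a)            ≡⟨ interchange F a (k * F) (j * a) ⟩
      suc k * F + suc j * a                ∎) flag′
    where
    open ≡-Reasoning
    regroup : ∀ x Y σ b B a N → x + Y + σ * a + (b + B) * N ≡ (x + b * N) + (Y + σ * a + B * N)
    regroup = solve-∀
    interchange : ∀ w x y z → (w + x) + (y + z) ≡ (w + y) + (x + z)
    interchange = solve-∀
    even-sum : ∀ t → B + k * a ≡ 2 * t → b + B + suc k * a ≡ 2 * (e + t)
    even-sum t B+ka≡2t = begin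
      b + B + (a + k * a)    ≡⟨ interchange b B a (k * a) ⟩
      (b + a) + (B + k * a)  ≡⟨ cong₂ _+_ b+a≡2e B+ka≡2t ⟩
      2 * e + 2 * t          ≡⟨ sym (*-distribˡ-+ 2 e t) ⟩
      2 * (e + t)            ∎
    flag′ : suc j < suc k ⊎ (σ ≡ 0 × Even (b + B + suc k * a))
    flag′ = [ (λ j<k → inj₁ (s≤s j<k)) , (λ { (σ≡0 , t , B+ka≡2t) → inj₂ (σ≡0 , e + t , even-sum t B+ka≡2t) }) ]′ flag

  sum-shape : ∀ {k} (v : Vec ℕ k) → AllV Gap v → k ≤ Vec.sum v × SumShape k (Vec.sum v)
  sum-shape [] []ᵛ = z≤n , shape 0 0 0 z≤n z≤n refl (inj₂ (refl , 0 , refl))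
  sum-shape (x ∷ v) ((1≤x , kind) ∷ᵛ gaps) with sum-shape v gaps
  ... | k≤Y , sumShape = +-mono-≤ 1≤x k≤Y , [ (λ first → add-first first sumShape) , (λ second → add-second second sumShape) ]′ kind

  δ≤iδ : ∀ i → 1 ≤ i → δ ≤ i * δ
  δ≤iδ (suc i) _ = m≤m+n δ (i * δ)

  SumOfGaps : ℕ → ℕ → Set
  SumOfGaps n y = ∃ λ (v : Vec ℕ n) → AllV (¬_ ∘ InSemigroup) v × y ≡ Vec.sum v

  -- An element s a + t N ≤ F of ⟨a, N⟩ has s ≤ N - 2 and t ≤ q - 1, because
  -- (N-1) a = F + N and q N = F + a both exceed F.
  box-bound-s : ∀ s t → s * a + t * N ≤ F → s ≤ N ∸ 2
  box-bound-s s t d≤F with s ≤? N ∸ 2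
  ... | yes s≤N-2 = s≤N-2
  ... | no  s≰N-2 = ⊥-elim (m+1+n≰m F (subst (_≤ F) 2ha≡F+N
                      (≤-trans (*-monoˡ-≤ a (≰⇒> s≰N-2)) (≤-trans (m≤m+n (s * a) (t * N)) d≤F))))
    where
    2ha≡F+N : 2 * h * a ≡ F + N
    2ha≡F+N = identity q' h'
      where
      identity : ∀ q' h' → 2 * suc h' * suc (suc q') ≡ suc (2 * (q' + h' * suc q')) + suc (2 * suc h')
      identity = solve-∀

  box-bound-t : ∀ s t → s * a + t * N ≤ F → t ≤ q'
  box-bound-t s t d≤F with t ≤? q'
  ... | yes t≤q' = t≤q'
  ... | no  t≰q' = ⊥-elim (m+1+n≰m F (subst (_≤ F) (sym F+a≡qN)
                      (≤-trans (*-monoˡ-≤ N (≰⇒> t≰q')) (≤-trans (m≤n+m (t * N) (s * a)) d≤F))))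

  -- Codes for the sums of n = n' + 2 gaps when g₀ ≥ 2.  A code κ below
  -- budget = (2n-1)(g₀+γ-1) is decoded by `decode`; the first (2n-1)G codes
  -- describe sums nF - d with d ∈ ⟨a, N⟩, the last (2n-1)γ codes the other sums.
  module Encoding (n' : ℕ) (G≥1 : 1 ≤ G) where

    n T R P mainCodes budget : ℕ
    n         = suc (suc n')
    T         = 2 * n ∸ 1
    R         = suc n' * (2 * γ)
    P         = parity (n * δ + n * a)
    mainCodes = T * G
    budget    = T * (g₀ + γ ∸ 1)

    -- The pairs (s, t) with s ≤ N-2, t ≤ q-1 form a box, symmetric under
    -- (s, t) ↦ (N-2-s, q-1-t), which sends the value s a + t N to 2F minus it;
    -- the g₀ codes s q + t with s < h name one pair of each symmetric couple,
    -- and decode to the member of value ≤ F.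
    mirror : ℕ → ℕ → ℕ
    mirror s t = (N ∸ 2 ∸ s) * a + (q' ∸ t) * N

    decodeBox : ℕ → ℕ
    decodeBox κ = ifDec (s * a + t * N ≤? F) (s * a + t * N) (mirror s t)
      where
      s t : ℕ
      s = κ / q
      t = κ % q

    -- The complement d = nF - Y of a main sum.
    decodeMain : ℕ → ℕ
    decodeMain κ = ifDec (κ <? g₀) (decodeBox κ) (κ + g₀)

    -- Extra sums Y with Y + MN = nF + ia and iδ ≤ M < iδ + 2γ: for i < n the
    -- code is (i-1)2γ + (M - iδ); for i = n the parity of M - nδ is fixed, so
    -- the code R + (M - nδ)/2 suffices.
    decodeExtra : ℕ → ℕ
    decodeExtra κ = ifDec (κ <? R) ((n * F + i * a) ∸ (i * δ + κ % (2 * γ)) * N)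
                                   ((n * F + n * a) ∸ (n * δ + (2 * (κ ∸ R) + P)) * N)
      where
      i : ℕ
      i = suc (κ / (2 * γ))

    decode : ℕ → ℕ
    decode κ = ifDec (κ <? mainCodes) (n * F ∸ decodeMain κ) (decodeExtra (κ ∸ mainCodes))

    T≡ : T ≡ 3 + 2 * n'
    T≡ = 2[2+n]∸1 n'

    budget≡ : budget ≡ mainCodes + T * γ
    budget≡ = *-distribˡ-+ T G γ

    R+γ≡Tγ : R + γ ≡ T * γ
    R+γ≡Tγ = trans (identity n' γ) (cong (_* γ) (sym T≡))
      where
      identity : ∀ n' γ → suc n' * (2 * γ) + γ ≡ (3 + 2 * n') * γ
      identity = solve-∀

    g₀≤mainCodes : g₀ ≤ mainCodes
    g₀≤mainCodes = subst (g₀ ≤_) (cong (_* G) (sym T≡))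
      (≤-trans (subst (_≤ G + G) (+-comm G 1) (+-monoʳ-≤ G G≥1)) (+-monoʳ-≤ G (m≤m+n G _)))

    mainCodes+G : mainCodes + G ≡ n * (2 * G)
    mainCodes+G = begin
      T * G + G        ≡⟨ +-comm (T * G) G ⟩
      (1 + T) * G      ≡⟨ cong (_* G) (m+[n∸m]≡n {1} {2 * n} (s≤s z≤n)) ⟩
      2 * n * G        ≡⟨ *-assoc 2 n G ⟩
      2 * (n * G)      ≡⟨ *-comm 2 (n * G) ⟩
      n * G * 2        ≡⟨ *-assoc n G 2 ⟩
      n * (G * 2)      ≡⟨ cong (n *_) (*-comm G 2) ⟩
      n * (2 * G)      ∎
      where open ≡-Reasoning

    mainCodes≤budget : mainCodes ≤ budget
    mainCodes≤budget = subst (mainCodes ≤_) (sym budget≡) (m≤m+n mainCodes (T * γ))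

    decodeBox-pair : ∀ s t → t < q → decodeBox (s * q + t) ≡ ifDec (s * a + t * N ≤? F) (s * a + t * N) (mirror s t)
    decodeBox-pair s t t<q rewrite proj₁ (divmod-linear s t q t<q) | proj₂ (divmod-linear s t q t<q) = refl

    box-code-bound : ∀ {s t} → s < h → t < q → s * q + t < g₀
    box-code-bound {s} {t} s<h t<q =
      ≤-trans (+-monoʳ-< (s * q) t<q) (subst (_≤ h * q) (+-comm q (s * q)) (*-monoˡ-≤ q s<h))

    box-code : ∀ s t → s * a + t * N ≤ F → ∃ λ κ → κ < g₀ × decodeBox κ ≡ s * a + t * N
    box-code s t d≤F with s <? h | box-bound-s s t d≤F | box-bound-t s t d≤F
    ... | yes s<h | _ | t≤q' = s * q + t , box-code-bound s<h (s≤s t≤q') ,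
          trans (decodeBox-pair s t (s≤s t≤q')) (ifDec-yes (s * a + t * N ≤? F) d≤F)
    -- For s ≥ h, (s, t) is the mirror image of (s̄, t̄) with s̄ < h.
    ... | no s≮h | s≤N-2 | t≤q' = s̄ * q + t̄ , box-code-bound s̄<h (s≤s (m∸n≤m q' t)) , decodes
      where
      s̄ t̄ : ℕ
      s̄ = N ∸ 2 ∸ s
      t̄ = q' ∸ t
      s̄<h : s̄ < h
      s̄<h = s≤s (+-cancelʳ-≤ h s̄ h' (≤-trans (+-monoʳ-≤ s̄ (≮⇒≥ s≮h))
                (≤-reflexive (trans (m∸n+n≡m s≤N-2) (cong (λ z → h' + suc z) (+-identityʳ h'))))))
      pair-sum : (s̄ * a + t̄ * N) + (s * a + t * N) ≡ F + F
      pair-sum = begin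
        (s̄ * a + t̄ * N) + (s * a + t * N)  ≡⟨ collect s̄ s t̄ t a N ⟩
        (s̄ + s) * a + (t̄ + t) * N          ≡⟨ cong₂ (λ x y → x * a + y * N) (m∸n+n≡m s≤N-2) (m∸n+n≡m t≤q') ⟩
        (N ∸ 2) * a + q' * N               ≡⟨ box-corner q' h' ⟩
        F + F                              ∎
        where
        open ≡-Reasoning
        collect : ∀ σ s τ t a N → (σ * a + τ * N) + (s * a + t * N) ≡ (σ + s) * a + (τ + t) * N
        collect = solve-∀
        box-corner : ∀ q' h' → (h' + suc (h' + 0)) * suc (suc q') + q' * suc (2 * suc h')
                               ≡ suc (2 * (q' + h' * suc q')) + suc (2 * (q' + h' * suc q'))
        box-corner = solve-∀
      decodes : decodeBox (s̄ * q + t̄) ≡ s * a + t * N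
      decodes with s̄ * a + t̄ * N ≤? F | decodeBox-pair s̄ t̄ (s≤s (m∸n≤m q' t))
      ... | yes v≤F | eq = trans eq (equal-halves _ _ F pair-sum v≤F d≤F)
      ... | no  _   | eq = trans eq (cong₂ (λ x y → x * a + y * N) (m∸[m∸n]≡n s≤N-2) (m∸[m∸n]≡n t≤q'))

    -- A sum Y ≥ n with Y + d = nF, d = s a + t N ∈ ⟨a, N⟩, has a main code:
    -- from the box when d ≤ F, and d - g₀ otherwise, where 2g₀ ≤ d ≤ nF - n = 2nG
    -- puts d - g₀ below (2n-1)G.
    code-main : ∀ Y s t → Y + (s * a + t * N) ≡ n * F → n ≤ Y → Coded decode budget Y
    code-main Y s t Yd n≤Y with s * a + t * N ≤? F
    ... | yes d≤F with box-code s t d≤F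
    ...   | κ , κ<g₀ , boxed = κ , ≤-trans κ<g₀ (≤-trans g₀≤mainCodes mainCodes≤budget) , (begin
            decode κ                 ≡⟨ ifDec-yes (κ <? mainCodes) (≤-trans κ<g₀ g₀≤mainCodes) ⟩
            n * F ∸ decodeMain κ     ≡⟨ cong (n * F ∸_) (trans (ifDec-yes (κ <? g₀) κ<g₀) boxed) ⟩
            n * F ∸ (s * a + t * N)  ≡⟨ difference Y _ _ Yd ⟩
            Y                        ∎)
      where open ≡-Reasoning
    code-main Y s t Yd n≤Y | no d≰F = d ∸ g₀ , ≤-trans κ<mainCodes mainCodes≤budget , (begin
        decode (d ∸ g₀)              ≡⟨ ifDec-yes ((d ∸ g₀) <? mainCodes) κ<mainCodes ⟩
        n * F ∸ decodeMain (d ∸ g₀)  ≡⟨ cong (n * F ∸_) (trans (ifDec-no ((d ∸ g₀) <? g₀) (≤⇒≯ g₀≤κ)) (m∸n+n≡m g₀≤d)) ⟩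
        n * F ∸ d                    ≡⟨ difference Y d _ Yd ⟩
        Y                            ∎)
      where
      open ≡-Reasoning
      d : ℕ
      d = s * a + t * N
      2g₀≤d : g₀ + g₀ ≤ d
      2g₀≤d = subst (_≤ d) (identity G) (≰⇒> d≰F)
        where
        identity : ∀ G → suc (suc (2 * G)) ≡ suc G + suc G
        identity = solve-∀
      g₀≤d : g₀ ≤ d
      g₀≤d = ≤-trans (m≤m+n g₀ g₀) 2g₀≤d
      g₀≤κ : g₀ ≤ d ∸ g₀
      g₀≤κ = +-cancelʳ-≤ g₀ g₀ (d ∸ g₀) (subst (g₀ + g₀ ≤_) (sym (m∸n+n≡m g₀≤d)) 2g₀≤d)
      d≤2nG : d ≤ n * (2 * G)
      d≤2nG = +-cancelˡ-≤ n d (n * (2 * G)) (subst (n + d ≤_) (trans Yd (*-suc n (2 * G))) (+-monoˡ-≤ d n≤Y))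
      κ<mainCodes : d ∸ g₀ < mainCodes
      κ<mainCodes = +-cancelʳ-≤ G (suc (d ∸ g₀)) mainCodes
        (subst₂ _≤_ (trans (sym (m∸n+n≡m g₀≤d)) (+-suc (d ∸ g₀) G)) (sym mainCodes+G) d≤2nG)

    code-extra : ∀ Y κ → κ < T * γ → decodeExtra κ ≡ Y → Coded decode budget Y
    code-extra Y κ κ<Tγ decodes =
      mainCodes + κ , subst (mainCodes + κ <_) (sym budget≡) (+-monoʳ-< mainCodes κ<Tγ) , (begin
        decode (mainCodes + κ)                ≡⟨ ifDec-no (mainCodes + κ <? mainCodes) (λ p → 1+n≰n (≤-trans p (m≤m+n mainCodes κ))) ⟩
        decodeExtra (mainCodes + κ ∸ mainCodes) ≡⟨ cong decodeExtra (m+n∸m≡n mainCodes κ) ⟩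
        decodeExtra κ                         ≡⟨ decodes ⟩
        Y                                     ∎)
      where open ≡-Reasoning

    code-partial : ∀ Y i M → 1 ≤ i → i < n → i * δ ≤ M → M < 2 * γ + i * δ
                 → Y + M * N ≡ n * F + i * a → Coded decode budget Y
    code-partial Y i M 1≤i i<n iδ≤M M< eq = code-extra Y κ (≤-trans κ<R R≤Tγ) decodes
      where
      open ≡-Reasoning
      K κ : ℕ
      K = M ∸ i * δ
      κ = (i ∸ 1) * (2 * γ) + K
      iδ+K≡M : i * δ + K ≡ M
      iδ+K≡M = m+[n∸m]≡n iδ≤M
      K<2γ : K < 2 * γ
      K<2γ = offset-below (i * δ) (2 * γ) M iδ≤M M<
      i-1+1≡i : suc (i ∸ 1) ≡ i
      i-1+1≡i = m+[n∸m]≡n 1≤i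
      κ<R : κ < R
      κ<R = ≤-trans (subst (suc κ ≤_) (+-comm ((i ∸ 1) * (2 * γ)) (2 * γ)) (+-monoʳ-< ((i ∸ 1) * (2 * γ)) K<2γ))
                    (*-monoˡ-≤ (2 * γ) (subst (_≤ suc n') (sym i-1+1≡i) (≤-pred i<n)))
      R≤Tγ : R ≤ T * γ
      R≤Tγ = subst (R ≤_) R+γ≡Tγ (m≤m+n R γ)
      decodes : decodeExtra κ ≡ Y
      decodes = begin
        decodeExtra κ
          ≡⟨ ifDec-yes (κ <? R) κ<R ⟩
        (n * F + suc (κ / (2 * γ)) * a) ∸ (suc (κ / (2 * γ)) * δ + κ % (2 * γ)) * N
          ≡⟨ cong₂ (λ j r → (n * F + j * a) ∸ (j * δ + r) * N)
                   (trans (cong suc (proj₁ (divmod-linear (i ∸ 1) K (2 * γ) K<2γ))) i-1+1≡i)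
                   (proj₂ (divmod-linear (i ∸ 1) K (2 * γ) K<2γ)) ⟩
        (n * F + i * a) ∸ (i * δ + K) * N
          ≡⟨ cong (λ z → (n * F + i * a) ∸ z * N) iδ+K≡M ⟩
        (n * F + i * a) ∸ M * N
          ≡⟨ difference Y (M * N) _ eq ⟩
        Y ∎

    -- Extra sums Y + MN = nF + na with nδ ≤ M < 2γ + nδ and M + na even: the
    -- parity of K = M - nδ is P, so K is recovered from K/2.
    code-full : ∀ Y M → n * δ ≤ M → M < 2 * γ + n * δ → Y + M * N ≡ n * F + n * a
              → Even (M + n * a) → Coded decode budget Y
    code-full Y M nδ≤M M< eq (e , M+na≡2e) = code-extra Y κ κ<Tγ decodes
      where
      open ≡-Reasoning
      K κ : ℕ
      K = M ∸ n * δ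
      κ = R + half K
      nδ+K≡M : n * δ + K ≡ M
      nδ+K≡M = m+[n∸m]≡n nδ≤M
      K<2γ : K < 2 * γ
      K<2γ = offset-below (n * δ) (2 * γ) M nδ≤M M<
      half-K<γ : half K < γ
      half-K<γ = *-cancelˡ-< 2 (half K) γ
        (≤-<-trans (subst (2 * half K ≤_) (parity+2half K) (m≤n+m (2 * half K) (parity K))) K<2γ)
      κ<Tγ : κ < T * γ
      κ<Tγ = subst (κ <_) R+γ≡Tγ (+-monoʳ-< R half-K<γ)
      parity-K : parity K ≡ P
      parity-K = parity-of-even-sum K (n * δ + n * a) (e , (begin
        K + (n * δ + n * a)  ≡⟨ sym (+-assoc K (n * δ) (n * a)) ⟩
        K + n * δ + n * a    ≡⟨ cong (_+ n * a) (trans (+-comm K (n * δ)) nδ+K≡M) ⟩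
        M + n * a            ≡⟨ M+na≡2e ⟩
        2 * e                ∎))
      K≡ : 2 * half K + P ≡ K
      K≡ = trans (+-comm (2 * half K) P) (trans (cong (_+ 2 * half K) (sym parity-K)) (parity+2half K))
      decodes : decodeExtra κ ≡ Y
      decodes = begin
        decodeExtra κ
          ≡⟨ ifDec-no (κ <? R) (λ p → 1+n≰n (≤-trans p (m≤m+n R (half K)))) ⟩
        (n * F + n * a) ∸ (n * δ + (2 * (κ ∸ R) + P)) * N
          ≡⟨ cong (λ z → (n * F + n * a) ∸ (n * δ + (2 * z + P)) * N) (m+n∸m≡n R (half K)) ⟩
        (n * F + n * a) ∸ (n * δ + (2 * half K + P)) * N
          ≡⟨ cong (λ z → (n * F + n * a) ∸ (n * δ + z) * N) K≡ ⟩
        (n * F + n * a) ∸ (n * δ + K) * N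
          ≡⟨ cong (λ z → (n * F + n * a) ∸ z * N) nδ+K≡M ⟩
        (n * F + n * a) ∸ M * N
          ≡⟨ difference Y (M * N) _ eq ⟩
        Y ∎

    code-rest : ∀ Y i M → 1 ≤ i → i ≤ n → i * δ ≤ M → M < 2 * γ + i * δ → Y + M * N ≡ n * F + i * a
              → (i ≡ n → Even (M + n * a)) → Coded decode budget Y
    code-rest Y i M 1≤i i≤n iδ≤M M< eq even with i <? n
    ... | yes i<n = code-partial Y i M 1≤i i<n iδ≤M M< eq
    ... | no  i≮n with ≤-antisym i≤n (≮⇒≥ i≮n)
    ...   | refl = code-full Y M iδ≤M M< eq (even refl)

    cancel-main : ∀ Y σ B j → j ≤ σ → Y + σ * a + B * N ≡ n * F + j * a → Y + ((σ ∸ j) * a + B * N) ≡ n * F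
    cancel-main Y σ B j j≤σ eq = +-cancelʳ-≡ (j * a) _ _ (begin
      Y + ((σ ∸ j) * a + B * N) + j * a  ≡⟨ collect Y (σ ∸ j) B j a N ⟩
      Y + (σ ∸ j + j) * a + B * N        ≡⟨ cong (λ z → Y + z * a + B * N) (m∸n+n≡m j≤σ) ⟩
      Y + σ * a + B * N                  ≡⟨ eq ⟩
      n * F + j * a                      ∎)
      where
      open ≡-Reasoning
      collect : ∀ Y s t i a N → Y + (s * a + t * N) + i * a ≡ Y + (s + i) * a + t * N
      collect = solve-∀

    cancel-rest : ∀ Y σ B j → σ ≤ j → Y + σ * a + B * N ≡ n * F + j * a → Y + B * N ≡ n * F + (j ∸ σ) * a
    cancel-rest Y σ B j σ≤j eq = +-cancelʳ-≡ (σ * a) _ _ (begin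
      Y + B * N + σ * a            ≡⟨ swap Y (B * N) (σ * a) ⟩
      Y + σ * a + B * N            ≡⟨ eq ⟩
      n * F + j * a                ≡⟨ cong (λ z → n * F + z * a) (sym (m∸n+n≡m σ≤j)) ⟩
      n * F + (j ∸ σ + σ) * a      ≡⟨ split Y (j ∸ σ) σ a (n * F) ⟩
      n * F + (j ∸ σ) * a + σ * a  ∎)
      where
      open ≡-Reasoning
      swap : ∀ x y z → x + y + z ≡ x + z + y
      swap = solve-∀
      split : ∀ Y i σ a X → X + (i + σ) * a ≡ X + i * a + σ * a
      split = solve-∀

    trade : ∀ Y M X → a ≤ M → Y + M * N ≡ X → Y + N * a + (M ∸ a) * N ≡ X
    trade Y M X a≤M eq = begin
      Y + N * a + (M ∸ a) * N  ≡⟨ collect Y (M ∸ a) a N ⟩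
      Y + (M ∸ a + a) * N      ≡⟨ cong (λ z → Y + z * N) (m∸n+n≡m a≤M) ⟩
      Y + M * N                ≡⟨ eq ⟩
      X                        ∎
      where
      open ≡-Reasoning
      collect : ∀ Y t a N → Y + N * a + t * N ≡ Y + (t + a) * N
      collect = solve-∀

    -- While i > N and
    -- M ≥ a + (i-N)δ, trading a N for N a passes to (i - N, M - a).  Then either
    -- i ≤ N and M ≥ a, and Y is a main sum with d = (N-i)a + (M-a)N, or
    -- M < 2γ + iδ and Y is an extra sum.  The fuel bounds i, hence the passes.
    reduce : ∀ fuel Y i M → i ≤ fuel → 1 ≤ i → i ≤ n → i * δ ≤ M → Y + M * N ≡ n * F + i * a
           → (i ≡ n → Even (M + n * a)) → n ≤ Y → Coded decode budget Y
    reduce zero Y i M i≤0 1≤i = ⊥-elim (1+n≰n (≤-trans 1≤i i≤0))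
    reduce (suc fuel) Y i M i≤fuel 1≤i i≤n iδ≤M eq even n≤Y with i ≤? N | a ≤? M
    ... | yes i≤N | yes a≤M = code-main Y (N ∸ i) (M ∸ a) (cancel-main Y N (M ∸ a) i i≤N (trade Y M _ a≤M eq)) n≤Y
    ... | yes i≤N | no a≰M = code-rest Y i M 1≤i i≤n iδ≤M M<2γ+iδ eq even
      where
      M<2γ+iδ : M < 2 * γ + i * δ
      M<2γ+iδ = ≤-trans (≰⇒> a≰M) (≤-trans (m≤n+m∸n a (2 * γ)) (+-monoʳ-≤ (2 * γ) (δ≤iδ i 1≤i)))
    ... | no i≰N | _ with a + (i ∸ N) * δ ≤? M
    ...   | yes large = reduce fuel Y (i ∸ N) (M ∸ a) (≤-pred (≤-trans i-N<i i≤fuel)) (m<n⇒0<n∸m (≰⇒> i≰N))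
                          (≤-trans (m∸n≤m i N) i≤n) (subst (_≤ M ∸ a) (m+n∸m≡n a _) (∸-monoˡ-≤ a large))
                          (cancel-rest Y N (M ∸ a) i (<⇒≤ (≰⇒> i≰N)) (trade Y M _ (≤-trans (m≤m+n a _) large) eq))
                          (λ i-N≡n → ⊥-elim (<⇒≱ i-N<i (subst (i ≤_) (sym i-N≡n) i≤n))) n≤Y
      where
      i-N<i : i ∸ N < i
      i-N<i = subst (i ∸ N <_) (m∸n+n≡m (<⇒≤ (≰⇒> i≰N))) (m<m+n (i ∸ N) (s≤s z≤n))
    ...   | no small = code-rest Y i M 1≤i i≤n iδ≤M M<2γ+iδ eq even
      where
      i-N<i : suc (i ∸ N) ≤ i
      i-N<i = subst (suc (i ∸ N) ≤_) (m∸n+n≡m (<⇒≤ (≰⇒> i≰N))) (m<m+n (i ∸ N) (s≤s z≤n))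
      M<2γ+iδ : M < 2 * γ + i * δ
      M<2γ+iδ = ≤-trans (≰⇒> small) (≤-trans (+-monoˡ-≤ ((i ∸ N) * δ) (m≤n+m∸n a (2 * γ)))
                  (subst (_≤ 2 * γ + i * δ) (sym (+-assoc (2 * γ) δ ((i ∸ N) * δ)))
                    (+-monoʳ-≤ (2 * γ) (*-monoˡ-≤ δ i-N<i))))

    encode : ∀ Y → n ≤ Y → SumShape n Y → Coded decode budget Y
    encode Y n≤Y (shape j σ B j≤n jδ≤B balance flag) with j ≤? σ
    ... | yes j≤σ = code-main Y (σ ∸ j) B (cancel-main Y σ B j j≤σ balance) n≤Y
    ... | no j≰σ = reduce (j ∸ σ) Y (j ∸ σ) B ≤-refl (m<n⇒0<n∸m (≰⇒> j≰σ)) (≤-trans i≤j j≤n)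
                     (≤-trans (*-monoˡ-≤ δ i≤j) jδ≤B) (cancel-rest Y σ B j (<⇒≤ (≰⇒> j≰σ)) balance) all-second n≤Y
      where
      i≤j : j ∸ σ ≤ j
      i≤j = m∸n≤m j σ
      all-second : j ∸ σ ≡ n → Even (B + n * a)
      all-second i≡n = [ (λ j<n → ⊥-elim (<⇒≱ j<n (subst (_≤ j) i≡n i≤j))) , proj₂ ]′ flag

    sumset-bound : Coprime N a → (ys : List ℕ) → Unique ys → All (SumOfGaps n) ys → length ys ≤ budget
    sumset-bound coprime ys unique sums = length≤codes decode budget ys unique (All.map code sums)
      where
      code : ∀ {y} → SumOfGaps n y → Coded decode budget y
      code (v , gaps , refl) with sum-shape v (AllV.map (gap-kind coprime _) gaps)
      ... | n≤Y , sumShape = encode (Vec.sum v) n≤Y sumShape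

-- When N = 3 and q = 1 (so g₀ = 1) the gaps of S are 1 and 3: a sum of n gaps
-- is n + 2c with c ≤ n, leaving n + 1 < (2n-1)γ possible values.
module SmallestCase (γ' : ℕ) where
  open Setting 0 0 γ'

  -- Here F = 1 and F + a = 3.
  gap-1-or-3 : ∀ x → Gap x → x ≡ 1 ⊎ x ≡ 3
  gap-1-or-3 x (1≤x , inj₁ (s , t , eq)) =
    inj₁ (≤-antisym (subst (x ≤_) eq (≤-trans (m≤m+n x (s * 2)) (m≤m+n (x + s * 2) (t * 3)))) 1≤x)
  gap-1-or-3 x (1≤x , inj₂ (zero , eq , _)) = inj₂ (trans (sym (+-identityʳ x)) eq)
  gap-1-or-3 x (1≤x , inj₂ (suc b , eq , _)) =
    ⊥-elim (<-irrefl (sym (trans (+-assoc x 3 (b * 3)) eq)) (≤-trans (+-monoˡ-≤ 3 1≤x) (m≤m+n (x + 3) (b * 3))))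

  sum-of-1s-and-3s : ∀ {k} (v : Vec ℕ k) → AllV (λ x → x ≡ 1 ⊎ x ≡ 3) v → ∃ λ c → c ≤ k × Vec.sum v ≡ k + 2 * c
  sum-of-1s-and-3s [] []ᵛ = 0 , z≤n , refl
  sum-of-1s-and-3s (x ∷ v) (_ ∷ᵛ rest) with sum-of-1s-and-3s v rest
  sum-of-1s-and-3s (.1 ∷ v) (inj₁ refl ∷ᵛ rest) | c , c≤k , eq = c , m≤n⇒m≤1+n c≤k , cong suc eq
  sum-of-1s-and-3s (.3 ∷ v) (inj₂ refl ∷ᵛ rest) | c , c≤k , eq = suc c , s≤s c≤k , trans (cong (3 +_) eq) (identity _ c)
    where
    identity : ∀ k c → 3 + (k + 2 * c) ≡ suc k + 2 * suc c
    identity = solve-∀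

  sumset-bound : Coprime N a → ∀ n' (ys : List ℕ) → Unique ys → All (SumOfGaps (suc (suc n'))) ys
               → length ys ≤ (2 * suc (suc n') ∸ 1) * (g₀ + γ ∸ 1)
  sumset-bound coprime n' ys unique sums = length≤codes (λ c → n + 2 * c) _ ys unique (All.map code sums)
    where
    n : ℕ
    n = suc (suc n')
    n<bound : n < (2 * n ∸ 1) * γ
    n<bound = subst (λ T → n < T * γ) (sym (2[2+n]∸1 n'))
                (≤-trans (s≤s (s≤s (s≤s (m≤m+n n' (n' + 0))))) (m≤m*n (3 + 2 * n') γ))
    code : ∀ {y} → SumOfGaps n y → Coded (λ c → n + 2 * c) ((2 * n ∸ 1) * γ) y
    code (v , gaps , refl) with sum-of-1s-and-3s v (AllV.map (gap-1-or-3 _ ∘ gap-kind coprime _) gaps)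
    ... | c , c≤n , eq = c , ≤-<-trans c≤n n<bound , sym eq

-- Proposition 3.5 for N = 2h + 1 and n ≥ 2, in terms of S; the smallest case
-- g₀ = 1 (h = q = 1) is separate, all others have g₀ ≥ 2.
gap-sumset-bound : ∀ h' q' γ' n' → let open Setting h' q' γ' in
  Coprime N a → (ys : List ℕ) → Unique ys → All (SumOfGaps (suc (suc n'))) ys
  → length ys ≤ (2 * suc (suc n') ∸ 1) * (g₀ + γ ∸ 1)
gap-sumset-bound zero      zero      γ' n' coprime = SmallestCase.sumset-bound γ' coprime n'
gap-sumset-bound h'        (suc q'') γ' n' coprime = Setting.Encoding.sumset-bound h' (suc q'') γ' n' (s≤s z≤n) coprime
gap-sumset-bound (suc h'') zero      γ' n' coprime = Setting.Encoding.sumset-bound (suc h'') zero γ' n' (s≤s z≤n) coprime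

odd-prime : ∀ N → Prime N → 3 ≤ N → ∃ λ h' → N ≡ suc (2 * suc h')
odd-prime N pN 3≤N with parity N | half N | parity+2half N | parity≤1 N
... | suc (suc _) | _      | _    | s≤s ()
... | suc zero    | suc h' | odd  | _ = h' , sym odd
... | suc zero    | zero   | N≡1  | _ = ⊥-elim (3≰1 (subst (3 ≤_) (sym N≡1) 3≤N))
  where
  3≰1 : ¬ 3 ≤ 1
  3≰1 (s≤s ())
... | zero        | H      | even | _ with prime⇒irreducible pN (divides H (trans (sym even) (*-comm 2 H)))
...   | inj₁ ()
...   | inj₂ 2≡N = ⊥-elim (<-irrefl 2≡N 3≤N)

prime-coprime : ∀ {p m} → Prime p → ¬ p ∣ m → Coprime p m
prime-coprime pN p∤m (d∣p , d∣m) with prime⇒irreducible pN d∣p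
... | inj₁ d≡1 = d≡1
... | inj₂ d≡p = ⊥-elim (p∤m (subst (_∣ _) d≡p d∣m))

g-γ≡qh : ∀ h' g γ → quot (suc (2 * suc h') ∸ 1) 2 ∣ (g ∸ γ) → g ∸ γ ≡ qq (suc (2 * suc h')) g γ * suc h'
g-γ≡qh h' g γ h∣ with subst (_∣ (g ∸ γ)) (trans (cong (_/ 2) (*-comm 2 (suc h'))) (m*n/n≡m (suc h') 2)) h∣
... | divides k g-γ≡kh = trans g-γ≡kh (cong (_* suc h') (sym q≡k))
  where
  q≡k : qq (suc (2 * suc h')) g γ ≡ k
  q≡k = trans (cong (_/ (2 * suc h')) (trans (cong (2 *_) g-γ≡kh) (identity k (suc h')))) (m*n/n≡m k (2 * suc h'))
    where
    identity : ∀ k h → 2 * (k * h) ≡ k * (2 * h)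
    identity = solve-∀

-- If q = 0 then every x lies in S_N (as x (q+1)), so nothing is a sum of gaps.
no-gaps : ∀ N g γ → qq N g γ ≡ 0 → ∀ x → InS N g γ x
no-gaps N g γ q≡0 x = 0 , x , (0 , 0 , refl) , (x , 0 , x≡) , sym (cong (_+ x) (*-zeroʳ N))
  where
  x≡ : x ≡ x * (qq N g γ + 1) + 0 * (qq N g γ + N + 1)
  x≡ = sym (trans (+-identityʳ _) (trans (cong (λ z → x * (z + 1)) q≡0) (*-identityʳ x)))

no-sums : ∀ {P : ℕ → Set} n' → (∀ x → ¬ P x) → ∀ ys → All (InSumset (suc n') P) ys → length ys ≤ 0
no-sums n' none []      []                              = z≤n
no-sums n' none (_ ∷ _) ((x ∷ _ , px ∷ᵛ _ , _) ∷ _)     = ⊥-elim (none x px)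

-- With qq N g γ = q ≥ 1 and N = 2h + 1, the set S_N of the statement is the
-- semigroup S of `Setting`.
module FromHypotheses (h' q' γ' g : ℕ) (q≡ : qq (suc (2 * suc h')) g (suc γ') ≡ suc q') where
  open Setting h' q' γ'

  in-S-N : ∀ {x} → InSemigroup x → InS N g γ x
  in-S-N (s , t , s∈ , (i , j , t≡) , x≡) = s , t , s∈ , (i , j , trans t≡ (cong₂ (λ A B → i * A + j * B) a≡ a+N≡)) , x≡
    where
    a≡ : a ≡ qq N g γ + 1
    a≡ = trans (cong suc (sym q≡)) (+-comm 1 _)
    a+N≡ : a + N ≡ qq N g γ + N + 1
    a+N≡ = trans (cong (λ z → suc z + N) (sym q≡)) (sym (+-comm (qq N g γ + N) 1))

  sums-agree : ∀ {n y} → InSumset n (InG N g γ) y → SumOfGaps n y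
  sums-agree (v , gaps , y≡) = v , AllV.map (λ gap → gap ∘ in-S-N) gaps , y≡

  -- The condition (q)_N ≠ N - 1 means N ∤ q + 1 = a.
  coprime : Prime N → res (qq N g γ) N ≢ N ∸ 1 → Coprime N a
  coprime pN res≢ = prime-coprime pN λ N∣a →
    res≢ (%-pred-≡0 {m = qq N g γ} (n∣m⇒m%n≡0 (suc (qq N g γ)) N (subst (N ∣_) (cong suc (sym q≡)) N∣a)))

bound-for : ∀ h' γ' n' g q → let N = suc (2 * suc h') in
  qq N g (suc γ') ≡ q → g ∸ suc γ' ≡ q * suc h' → suc γ' ≤ g → Prime N → res (qq N g (suc γ')) N ≢ N ∸ 1
  → (xs : List ℕ) → Unique xs → All (InSumset (suc (suc n')) (InG N g (suc γ'))) xs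
  → length xs ≤ (2 * suc (suc n') ∸ 1) * (g ∸ 1)
bound-for h' γ' n' g zero q≡0 _ _ _ _ xs _ sums =
  ≤-trans (no-sums (suc n') (λ x gap → gap (no-gaps (suc (2 * suc h')) g (suc γ') q≡0 x)) xs sums) z≤n
bound-for h' γ' n' g (suc q') q≡ g-γ≡qh γ≤g pN res≢ xs unique sums =
  subst (λ m → length xs ≤ (2 * suc (suc n') ∸ 1) * (m ∸ 1)) (sym g≡g₀+γ)
    (gap-sumset-bound h' q' γ' n' (coprime pN res≢) xs unique (All.map sums-agree sums))
  where
  open Setting h' q' γ' using (g₀)
  open FromHypotheses h' q' γ' g q≡
  g≡g₀+γ : g ≡ g₀ + suc γ'
  g≡g₀+γ = trans (sym (m∸n+n≡m γ≤g)) (cong (_+ suc γ') (trans g-γ≡qh (*-comm (suc q') (suc h'))))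

proposition3p5 : (N g γ : ℕ) → Prime N → N ≥ 3 → γ > 0 → g ≥ γ
    → quot (N ∸ 1) 2 ∣ (g ∸ γ)
    → res (qq N g γ) N ≢ N ∸ 1
    → (n : ℕ) → n ≥ 2
    → (xs : List ℕ) → Unique xs → All (InSumset n (InG N g γ)) xs
    → length xs ≤ (2 * n ∸ 1) * (g ∸ 1)
proposition3p5 N g zero _ _ () _ _ _ _ _ _ _ _
proposition3p5 N g (suc γ') _ _ _ _ _ _ zero () _ _ _
proposition3p5 N g (suc γ') _ _ _ _ _ _ (suc zero) (s≤s ()) _ _ _
proposition3p5 N g (suc γ') pN 3≤N _ γ≤g h∣g-γ res≢ (suc (suc n')) _ xs unique sums with odd-prime N pN 3≤N
... | h' , refl = bound-for h' γ' n' g _ refl (g-γ≡qh h' g (suc γ') h∣g-γ) γ≤g pN res≢ xs unique sums
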